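{- Let $G$ be a graph with vertex set $V$ and adjacency matrix $A$, and let $W\subseteq V$. Order $V$ with the vertices of $W$ first and write $A=\begin{pmatrix}P&Q\\ Q^T&R\end{pmatrix}$ in block form, where $P$ is the submatrix on rows and columns $W$, $Q$ has rows $W$ and columns $V\setminus W$, and $R$ is the submatrix on rows and columns $V\setminus W$. Then $W$ is reducible in $G$ if and only if the image (column space) of $Q$ is contained in the image of $P$; equivalently, if and only if there exists a matrix $M$ over $\mathbf{F}_2$ with $Q=PM$.
   Context: A graph is a finite graph with vertex set $V$, no multiple edges, in which each vertex may or may not carry a loop. Its adjacency matrix $A$ is the symmetric $V\times V$ matrix over $\mathbf{F}_2$ with $A_{vw}=1$ iff $v\ne w$ are adjacent and $A_{vv}=1$ iff $v$ has a loop. Let $\mathcal{V}$ be the $\mathbf{F}_2$-vector space with basis $V$ and $\mathcal{E}(x,y)=x^TAy$. For $W\subseteq V$, $\langle W\rangle$ denotes the span of $W$ and $\langle W\rangle^{\perp}=\{x\in\mathcal{V}:\mathcal{E}(x,w)=0\ \forall w\in\langle W\rangle\}$. $W$ is reducible in $G$ if $\langle W\rangle+\langle W\rangle^{\perp}=\mathcal{V}$. -}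

module Defs where

open import Data.Nat using (ℕ)
open import Data.Fin using (Fin; _≟_)
open import Relation.Nullary using (does)
open import Data.Bool using (Bool; true; false; _xor_; _∧_; if_then_else_)
open import Data.Product using (Σ; ∃; _×_; _,_)
open import Data.Sum using (_⊎_; inj₁; inj₂)
open import Data.Fin.Subset using (Subset; _∈_; _∉_)
open import Relation.Binary.PropositionalEquality using (_≡_; _≢_)

-- F₂ is Bool with xor as addition and ∧ as multiplication.
-- Vectors in F₂^I are functions I → Bool; equality of vectors is pointwise.

Σ₂ : ∀ {k} → (Fin k → Bool) → Bool
Σ₂ {ℕ.zero} f = false
Σ₂ {ℕ.suc k} f = f Fin.zero xor Σ₂ (λ i → f (Fin.suc i))

-- A graph on vertex set Fin n (loops allowed, no multiple edges),
-- given by its symmetric adjacency matrix over F₂.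
record Graph (n : ℕ) : Set where
  field
    adj : Fin n → Fin n → Bool
    sym : ∀ v w → adj v w ≡ adj w v
open Graph public

Vect : ℕ → Set
Vect n = Fin n → Bool

_≐_ : ∀ {n} → Vect n → Vect n → Set
x ≐ y = ∀ v → x v ≡ y v

_+ᵥ_ : ∀ {n} → Vect n → Vect n → Vect n
(x +ᵥ y) v = x v xor y v

basis : ∀ {n} → Fin n → Vect n
basis v w = does (v ≟ w)

ℰ : ∀ {n} → Graph n → Vect n → Vect n → Bool
ℰ G x y = Σ₂ (λ v → Σ₂ (λ w → x v ∧ (adj G v w ∧ y w)))

InSpan : ∀ {n} → Subset n → Vect n → Set
InSpan {n} W x =
  ∃ λ (c : Vect n) → (∀ v → v ∉ W → c v ≡ false)
                   × (x ≐ (λ u → Σ₂ (λ v → c v ∧ basis v u)))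

InPerp : ∀ {n} → Graph n → Subset n → Vect n → Set
InPerp G W x = ∀ w → InSpan W w → ℰ G x w ≡ false

Reducible : ∀ {n} → Graph n → Subset n → Set
Reducible G W = ∀ x → ∃ λ y → ∃ λ z →
  InSpan W y × InPerp G W z × (x ≐ (y +ᵥ z))

Mat : ℕ → ℕ → Set
Mat r c = Fin r → Fin c → Bool

_·ᵥ_ : ∀ {r c} → Mat r c → Vect c → Vect r
(M ·ᵥ x) i = Σ₂ (λ j → M i j ∧ x j)

_·_ : ∀ {r s c} → Mat r s → Mat s c → Mat r c
(M · N) i j = Σ₂ (λ l → M i l ∧ N l j)

ImageSub : ∀ {k m} → Mat k m → Mat k k → Set
ImageSub Q P = ∀ y → (∃ λ x → y ≐ (Q ·ᵥ x)) → ∃ λ x′ → y ≐ (P ·ᵥ x′)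

-- An ordering of V with the vertices of W first: a bijection
-- e : Fin k ⊎ Fin m → Fin n sending inj₁ exactly onto W.
record WFirst {n : ℕ} (W : Subset n) (k m : ℕ) : Set where
  field
    enum : Fin k ⊎ Fin m → Fin n
    enum-inj : ∀ a b → enum a ≡ enum b → a ≡ b
    enum-surj : ∀ v → ∃ λ a → enum a ≡ v
    enum-W : ∀ i → enum (inj₁ i) ∈ W
    enum-notW : ∀ j → enum (inj₂ j) ∉ W
open WFirst public

blockP : ∀ {n k m} {W : Subset n} → Graph n → WFirst W k m → Mat k k
blockP G o i i′ = adj G (enum o (inj₁ i)) (enum o (inj₁ i′))

blockQ : ∀ {n k m} {W : Subset n} → Graph n → WFirst W k m → Mat k m
blockQ G o i j = adj G (enum o (inj₁ i)) (enum o (inj₂ j))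

module Submission where

-- A vector of 𝒱 lies in ⟨W⟩ iff it vanishes off W, and it lies
-- in ⟨W⟩^⊥ iff it is orthogonal to every basis vector e_w with w ∈ W, i.e.
-- iff (Aᵀz)_w = 0 for w ∈ W.  Splitting z = (z₁ , z₂) along the ordering
-- "W first", the W-rows of Aᵀz read P z₁ + Q z₂ (A is symmetric), so over F₂
--            z ∈ ⟨W⟩^⊥   ⇔   P z₁ = Q z₂.
-- Hence x = y + z with y ∈ ⟨W⟩, z ∈ ⟨W⟩^⊥ forces z₂ = x₂ and P z₁ = Q x₂;
-- conversely if Q x₂ = P x₁ then z := (x₁ , x₂) and y := x + z do the job.
-- So W is reducible iff every Q x₂ lies in im P, and, testing on basis
-- vectors, iff Q = P M for some M.

open import Defs
open import Data.Nat using (zero; suc)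
open import Data.Fin using (Fin; _≟_)
open import Data.Fin.Subset using (Subset; _∈_; _∉_)
open import Data.Fin.Subset.Properties using (_∈?_)
open import Data.Fin.Properties using (suc-injective)
open import Data.Bool using (Bool; true; false; _xor_; _∧_)
open import Data.Bool.Properties
  using (∧-comm; ∧-assoc; ∧-zeroʳ; ∧-identityʳ; xor-same; xor-assoc; xor-identityʳ; xor-∧-commutativeRing)
open import Data.Product using (_×_; ∃; _,_; proj₁; proj₂)
open import Data.Sum using (_⊎_; inj₁; inj₂; [_,_]′)
open import Data.Sum.Properties using (inj₁-injective; inj₂-injective)
open import Data.Empty using (⊥-elim)
open import Relation.Nullary using (yes; no)
open import Function using (_∘_)
open import Function.Bundles using (_⇔_; mk⇔; Equivalence)
open import Function.Properties.Equivalence using () renaming (trans to ⇔-trans)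
open import Relation.Binary.PropositionalEquality
  using (_≡_; _≢_; refl; trans; cong; cong₂; module ≡-Reasoning)
import Relation.Binary.PropositionalEquality as ≡
open import Algebra.Bundles using (CommutativeRing)
open import Algebra.Properties.Semiring.Sum (CommutativeRing.semiring xor-∧-commutativeRing)
  using (sum; sum-cong-≗; sum-replicate-zero; ∑-distrib-+; ∑-comm; *-distribˡ-sum; *-distribʳ-sum)
open import Algebra.Properties.Group (CommutativeRing.+-group xor-∧-commutativeRing)
  using (x∙y⁻¹≈ε⇒x≈y)

open Equivalence using (to; from)
open ≡-Reasoning

-- Σ₂ is the library's summation over the Boolean ring (F₂, xor, ∧); this
-- lets every standard summation law be imported rather than re-proved.
Σ₂≡sum : ∀ {N} (f : Fin N → Bool) → Σ₂ f ≡ sum f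
Σ₂≡sum {zero}  f = refl
Σ₂≡sum {suc N} f = cong (f Fin.zero xor_) (Σ₂≡sum (f ∘ Fin.suc))

Σ₂-cong : ∀ {N} {f g : Fin N → Bool} → (∀ i → f i ≡ g i) → Σ₂ f ≡ Σ₂ g
Σ₂-cong {f = f} {g} f≗g = begin
  Σ₂ f   ≡⟨ Σ₂≡sum f ⟩
  sum f  ≡⟨ sum-cong-≗ f≗g ⟩
  sum g  ≡⟨ Σ₂≡sum g ⟨
  Σ₂ g   ∎

Σ₂-vanish : ∀ {N} (f : Fin N → Bool) → (∀ i → f i ≡ false) → Σ₂ f ≡ false
Σ₂-vanish {N} f f≗0 = begin
  Σ₂ f                   ≡⟨ Σ₂≡sum f ⟩
  sum f                  ≡⟨ sum-cong-≗ f≗0 ⟩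
  sum {N} (λ _ → false)  ≡⟨ sum-replicate-zero N ⟩
  false                  ∎

Σ₂-xor : ∀ {N} (f g : Fin N → Bool) → Σ₂ (λ i → f i xor g i) ≡ Σ₂ f xor Σ₂ g
Σ₂-xor f g = begin
  Σ₂ (λ i → f i xor g i)  ≡⟨ Σ₂≡sum (λ i → f i xor g i) ⟩
  sum (λ i → f i xor g i) ≡⟨ ∑-distrib-+ f g ⟩
  sum f xor sum g         ≡⟨ cong₂ _xor_ (Σ₂≡sum f) (Σ₂≡sum g) ⟨
  Σ₂ f xor Σ₂ g           ∎

Σ₂-swap : ∀ {N K} (f : Fin N → Fin K → Bool) →
  Σ₂ (λ i → Σ₂ (f i)) ≡ Σ₂ (λ j → Σ₂ (λ i → f i j))
Σ₂-swap f = begin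
  Σ₂ (λ i → Σ₂ (f i))              ≡⟨ double f ⟩
  sum (λ i → sum (f i))            ≡⟨ ∑-comm f ⟩
  sum (λ j → sum (λ i → f i j))    ≡⟨ double (λ j i → f i j) ⟨
  Σ₂ (λ j → Σ₂ (λ i → f i j))      ∎
  where
  double : ∀ {N K} (g : Fin N → Fin K → Bool) → Σ₂ (λ i → Σ₂ (g i)) ≡ sum (λ i → sum (g i))
  double g = trans (Σ₂-cong (λ i → Σ₂≡sum (g i))) (Σ₂≡sum (λ i → sum (g i)))

Σ₂-∧ˡ : ∀ {N} a (f : Fin N → Bool) → a ∧ Σ₂ f ≡ Σ₂ (λ i → a ∧ f i)
Σ₂-∧ˡ a f = trans (cong (a ∧_) (Σ₂≡sum f)) (trans (*-distribˡ-sum a f) (≡.sym (Σ₂≡sum (λ i → a ∧ f i))))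

Σ₂-∧ʳ : ∀ {N} a (f : Fin N → Bool) → Σ₂ f ∧ a ≡ Σ₂ (λ i → f i ∧ a)
Σ₂-∧ʳ a f = trans (cong (_∧ a) (Σ₂≡sum f)) (trans (*-distribʳ-sum a f) (≡.sym (Σ₂≡sum (λ i → f i ∧ a))))

Σ₂-single : ∀ {N} (f : Fin N → Bool) p → (∀ q → q ≢ p → f q ≡ false) → Σ₂ f ≡ f p
Σ₂-single {suc N} f Fin.zero     off = begin
  f Fin.zero xor Σ₂ (f ∘ Fin.suc) ≡⟨ cong (f Fin.zero xor_) (Σ₂-vanish _ (λ q → off (Fin.suc q) (λ ()))) ⟩
  f Fin.zero xor false            ≡⟨ xor-identityʳ _ ⟩
  f Fin.zero                      ∎
Σ₂-single {suc N} f (Fin.suc p) off =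
  cong₂ _xor_ (off Fin.zero (λ ())) (Σ₂-single (f ∘ Fin.suc) p (λ q q≢p → off (Fin.suc q) (q≢p ∘ suc-injective)))

Σ⊎ : ∀ {k m} → (Fin k ⊎ Fin m → Bool) → Bool
Σ⊎ g = Σ₂ (g ∘ inj₁) xor Σ₂ (g ∘ inj₂)

Σ⊎-single : ∀ {k m} (g : Fin k ⊎ Fin m → Bool) p → (∀ q → q ≢ p → g q ≡ false) → Σ⊎ g ≡ g p
Σ⊎-single g (inj₁ p) off = begin
  Σ₂ (g ∘ inj₁) xor Σ₂ (g ∘ inj₂) ≡⟨ cong₂ _xor_ (Σ₂-single (g ∘ inj₁) p (λ q q≢p → off (inj₁ q) (q≢p ∘ inj₁-injective)))
                                                 (Σ₂-vanish (g ∘ inj₂) (λ q → off (inj₂ q) (λ ()))) ⟩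
  g (inj₁ p) xor false            ≡⟨ xor-identityʳ _ ⟩
  g (inj₁ p)                      ∎
Σ⊎-single g (inj₂ p) off =
  cong₂ _xor_ (Σ₂-vanish (g ∘ inj₁) (λ q → off (inj₁ q) (λ ())))
              (Σ₂-single (g ∘ inj₂) p (λ q q≢p → off (inj₂ q) (q≢p ∘ inj₂-injective)))

Σ₂-Σ⊎-swap : ∀ {n k m} (g : Fin k ⊎ Fin m → Fin n → Bool) →
  Σ₂ (λ v → Σ⊎ (λ a → g a v)) ≡ Σ⊎ (λ a → Σ₂ (g a))
Σ₂-Σ⊎-swap g = trans (Σ₂-xor (λ v → Σ₂ (λ i → g (inj₁ i) v)) (λ v → Σ₂ (λ j → g (inj₂ j) v)))
  (cong₂ _xor_ (Σ₂-swap (λ v i → g (inj₁ i) v)) (Σ₂-swap (λ v j → g (inj₂ j) v)))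

∧-basis-self : ∀ {n} x (u : Fin n) → x ∧ basis u u ≡ x
∧-basis-self x u with u ≟ u
... | yes _  = ∧-identityʳ x
... | no u≢u = ⊥-elim (u≢u refl)

∧-basis-other : ∀ {n} x {u w : Fin n} → u ≢ w → x ∧ basis u w ≡ false
∧-basis-other x {u} {w} u≢w with u ≟ w
... | yes u≡w = ⊥-elim (u≢w u≡w)
... | no _    = ∧-zeroʳ x

basis-sym : ∀ {n} (u w : Fin n) → basis u w ≡ basis w u
basis-sym u w with u ≟ w | w ≟ u
... | yes _   | yes _   = refl
... | no _    | no _    = refl
... | yes u≡w | no w≢u  = ⊥-elim (w≢u (≡.sym u≡w))
... | no u≢w  | yes w≡u = ⊥-elim (u≢w (≡.sym w≡u))

δ-sumʳ : ∀ {n} (f : Vect n) u → Σ₂ (λ w → f w ∧ basis u w) ≡ f u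
δ-sumʳ f u = trans (Σ₂-single _ u (λ w w≢u → ∧-basis-other (f w) (w≢u ∘ ≡.sym))) (∧-basis-self (f u) u)

δ-sumˡ : ∀ {n} (f : Vect n) u → Σ₂ (λ v → f v ∧ basis v u) ≡ f u
δ-sumˡ f u = trans (Σ₂-cong (λ v → cong (f v ∧_) (basis-sym v u))) (δ-sumʳ f u)

Supported : ∀ {n} → Subset n → Vect n → Set
Supported W x = ∀ v → v ∉ W → x v ≡ false

inSpan⇔supported : ∀ {n} (W : Subset n) (x : Vect n) → InSpan W x ⇔ Supported W x
inSpan⇔supported W x = mk⇔
  (λ { (c , c-supp , x≐) v v∉W → trans (x≐ v) (trans (δ-sumˡ c v) (c-supp v v∉W)) })
  (λ x-supp → x , x-supp , λ u → ≡.sym (δ-sumˡ x u))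

colSum : ∀ {n} → Graph n → Vect n → Fin n → Bool
colSum G z u = Σ₂ (λ v → z v ∧ adj G v u)

ℰ-by-columns : ∀ {n} (G : Graph n) (z y : Vect n) → ℰ G z y ≡ Σ₂ (λ u → colSum G z u ∧ y u)
ℰ-by-columns G z y = begin
  Σ₂ (λ v → Σ₂ (λ u → z v ∧ (adj G v u ∧ y u)))  ≡⟨ Σ₂-cong (λ v → Σ₂-cong (λ u → ≡.sym (∧-assoc (z v) (adj G v u) (y u)))) ⟩
  Σ₂ (λ v → Σ₂ (λ u → (z v ∧ adj G v u) ∧ y u))  ≡⟨ Σ₂-swap (λ v u → (z v ∧ adj G v u) ∧ y u) ⟩
  Σ₂ (λ u → Σ₂ (λ v → (z v ∧ adj G v u) ∧ y u))  ≡⟨ Σ₂-cong (λ u → ≡.sym (Σ₂-∧ʳ (y u) (λ v → z v ∧ adj G v u))) ⟩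
  Σ₂ (λ u → colSum G z u ∧ y u)                  ∎

inPerp⇔columns : ∀ {n} (G : Graph n) (W : Subset n) (z : Vect n) →
  InPerp G W z ⇔ (∀ w → w ∈ W → colSum G z w ≡ false)
inPerp⇔columns G W z = mk⇔ onBasis fromBasis
  where
  onBasis : InPerp G W z → ∀ w → w ∈ W → colSum G z w ≡ false
  onBasis z⊥ w w∈W = begin
    colSum G z w                          ≡⟨ δ-sumʳ (colSum G z) w ⟨
    Σ₂ (λ u → colSum G z u ∧ basis w u)   ≡⟨ ℰ-by-columns G z (basis w) ⟨
    ℰ G z (basis w)                       ≡⟨ z⊥ (basis w) (from (inSpan⇔supported W _) eʷ-supported) ⟩
    false                                 ∎
    where
    eʷ-supported : Supported W (basis w)
    eʷ-supported v v∉W = ∧-basis-other true (λ w≡v → v∉W (≡.subst (_∈ W) w≡v w∈W))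

  fromBasis : (∀ w → w ∈ W → colSum G z w ≡ false) → InPerp G W z
  fromBasis cols y y∈⟨W⟩ = trans (ℰ-by-columns G z y) (Σ₂-vanish _ term)
    where
    term : ∀ u → colSum G z u ∧ y u ≡ false
    term u with u ∈? W
    ... | yes u∈W = cong (_∧ y u) (cols u u∈W)
    ... | no  u∉W = trans (cong (colSum G z u ∧_) (to (inSpan⇔supported W y) y∈⟨W⟩ u u∉W)) (∧-zeroʳ _)

·ᵥ-assoc : ∀ {r s c} (P : Mat r s) (M : Mat s c) (x : Vect c) → ∀ i → ((P · M) ·ᵥ x) i ≡ (P ·ᵥ (M ·ᵥ x)) i
·ᵥ-assoc P M x i = begin
  Σ₂ (λ j → Σ₂ (λ l → P i l ∧ M l j) ∧ x j)    ≡⟨ Σ₂-cong (λ j → Σ₂-∧ʳ (x j) (λ l → P i l ∧ M l j)) ⟩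
  Σ₂ (λ j → Σ₂ (λ l → (P i l ∧ M l j) ∧ x j))  ≡⟨ Σ₂-swap (λ j l → (P i l ∧ M l j) ∧ x j) ⟩
  Σ₂ (λ l → Σ₂ (λ j → (P i l ∧ M l j) ∧ x j))  ≡⟨ Σ₂-cong (λ l → Σ₂-cong (λ j → ∧-assoc (P i l) (M l j) (x j))) ⟩
  Σ₂ (λ l → Σ₂ (λ j → P i l ∧ (M l j ∧ x j)))  ≡⟨ Σ₂-cong (λ l → Σ₂-∧ˡ (P i l) (λ j → M l j ∧ x j)) ⟨
  Σ₂ (λ l → P i l ∧ (M ·ᵥ x) l)                ∎

imageSub⇔factor : ∀ {k m} (Q : Mat k m) (P : Mat k k) →
  ImageSub Q P ⇔ (∃ λ (M : Mat k m) → ∀ i j → Q i j ≡ (P · M) i j)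
imageSub⇔factor {k} {m} Q P = mk⇔ factor image
  where
  factor : ImageSub Q P → ∃ λ (M : Mat k m) → ∀ i j → Q i j ≡ (P · M) i j
  factor Q⊆P = M , λ i j → trans (≡.sym (δ-sumʳ (Q i) j)) (proj₂ (column j) i)
    where
    column : ∀ j → ∃ λ x′ → (Q ·ᵥ basis j) ≐ (P ·ᵥ x′)
    column j = Q⊆P (Q ·ᵥ basis j) (basis j , λ _ → refl)
    M : Mat k m
    M l j = proj₁ (column j) l

  image : (∃ λ (M : Mat k m) → ∀ i j → Q i j ≡ (P · M) i j) → ImageSub Q P
  image (M , Q≡PM) y (x , y≐Qx) = M ·ᵥ x , λ i → begin
    y i                   ≡⟨ y≐Qx i ⟩
    (Q ·ᵥ x) i            ≡⟨ Σ₂-cong (λ j → cong (_∧ x j) (Q≡PM i j)) ⟩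
    ((P · M) ·ᵥ x) i      ≡⟨ ·ᵥ-assoc P M x i ⟩
    (P ·ᵥ (M ·ᵥ x)) i     ∎

module Enumeration {k m n} (e : Fin k ⊎ Fin m → Fin n)
                   (e-inj : ∀ a b → e a ≡ e b → a ≡ b)
                   (e-surj : ∀ v → ∃ λ a → e a ≡ v) where

  reindex : (f : Vect n) → Σ₂ f ≡ Σ⊎ (f ∘ e)
  reindex f = begin
    Σ₂ f                                          ≡⟨ Σ₂-cong expand ⟨
    Σ₂ (λ v → Σ⊎ (λ a → f (e a) ∧ basis (e a) v))  ≡⟨ Σ₂-Σ⊎-swap (λ a v → f (e a) ∧ basis (e a) v) ⟩
    Σ⊎ (λ a → Σ₂ (λ v → f (e a) ∧ basis (e a) v))  ≡⟨ cong₂ _xor_ (Σ₂-cong (λ i → δ-sumʳ _ (e (inj₁ i))))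
                                                                  (Σ₂-cong (λ j → δ-sumʳ _ (e (inj₂ j)))) ⟩
    Σ⊎ (f ∘ e)                                    ∎
    where
    -- f v = Σ_a f(e a) [e a = v], the only surviving term being a = e⁻¹ v.
    expand : ∀ v → Σ⊎ (λ a → f (e a) ∧ basis (e a) v) ≡ f v
    expand v with e-surj v
    ... | p , refl = trans (Σ⊎-single _ p (λ a a≢p → ∧-basis-other (f (e a)) (a≢p ∘ e-inj a p)))
                           (∧-basis-self (f (e p)) (e p))

  glue : Vect k → Vect m → Vect n
  glue a b v = [ a , b ]′ (proj₁ (e-surj v))

  glue-enum : ∀ (a : Vect k) (b : Vect m) c → glue a b (e c) ≡ [ a , b ]′ c
  glue-enum a b c = cong [ a , b ]′ (e-inj _ c (proj₂ (e-surj (e c))))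

module Blocks {n k m} (G : Graph n) (W : Subset n) (o : WFirst W k m) where

  open Enumeration (enum o) (enum-inj o) (enum-surj o)

  P : Mat k k
  P = blockP G o
  Q : Mat k m
  Q = blockQ G o

  e₁ : Fin k → Fin n
  e₁ i = enum o (inj₁ i)
  e₂ : Fin m → Fin n
  e₂ j = enum o (inj₂ j)

  onW-elim : {B : Fin n → Set} → (∀ i → B (e₁ i)) → ∀ v → v ∈ W → B v
  onW-elim h v v∈W with enum-surj o v
  ... | inj₁ i , refl = h i
  ... | inj₂ j , refl = ⊥-elim (enum-notW o j v∈W)

  offW-elim : {B : Fin n → Set} → (∀ j → B (e₂ j)) → ∀ v → v ∉ W → B v
  offW-elim h v v∉W with enum-surj o v
  ... | inj₁ i , refl = ⊥-elim (v∉W (enum-W o i))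
  ... | inj₂ j , refl = h j

  colSum-block : (z : Vect n) → ∀ i →
    colSum G z (e₁ i) ≡ (P ·ᵥ (z ∘ e₁)) i xor (Q ·ᵥ (z ∘ e₂)) i
  colSum-block z i = trans (reindex (λ v → z v ∧ adj G v (e₁ i)))
    (cong₂ _xor_ (Σ₂-cong (λ i′ → transpose (e₁ i′))) (Σ₂-cong (λ j → transpose (e₂ j))))
    where
    transpose : ∀ v → z v ∧ adj G v (e₁ i) ≡ adj G (e₁ i) v ∧ z v
    transpose v = trans (∧-comm (z v) _) (cong (_∧ z v) (Graph.sym G v (e₁ i)))

  -- z ∈ ⟨W⟩^⊥ iff P z₁ = Q z₂; over F₂, a + b = 0 iff a = b (the additive
  -- group of F₂ has trivial negation).
  perp⇔blocks : (z : Vect n) → InPerp G W z ⇔ (∀ i → (P ·ᵥ (z ∘ e₁)) i ≡ (Q ·ᵥ (z ∘ e₂)) i)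
  perp⇔blocks z = mk⇔ blocks-equal orthogonal
    where
    Pz₁ Qz₂ : Vect k
    Pz₁ = P ·ᵥ (z ∘ e₁)
    Qz₂ = Q ·ᵥ (z ∘ e₂)

    blocks-equal : InPerp G W z → ∀ i → Pz₁ i ≡ Qz₂ i
    blocks-equal z⊥ i = x∙y⁻¹≈ε⇒x≈y (Pz₁ i) (Qz₂ i) (begin
      Pz₁ i xor Qz₂ i     ≡⟨ colSum-block z i ⟨
      colSum G z (e₁ i)   ≡⟨ to (inPerp⇔columns G W z) z⊥ (e₁ i) (enum-W o i) ⟩
      false               ∎)

    orthogonal : (∀ i → Pz₁ i ≡ Qz₂ i) → InPerp G W z
    orthogonal Pz₁≡Qz₂ = from (inPerp⇔columns G W z) (onW-elim {B = λ w → colSum G z w ≡ false} λ i → begin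
      colSum G z (e₁ i)   ≡⟨ colSum-block z i ⟩
      Pz₁ i xor Qz₂ i     ≡⟨ cong (_xor Qz₂ i) (Pz₁≡Qz₂ i) ⟩
      Qz₂ i xor Qz₂ i     ≡⟨ xor-same (Qz₂ i) ⟩
      false               ∎)

  -- In a decomposition x = y + z the ⟨W⟩-part y vanishes off W, so z₂ = x₂
  -- and P z₁ = Q x₂: the vector z₁ witnesses Q x₂ ∈ im P.
  reducible⇒imageSub : Reducible G W → ImageSub Q P
  reducible⇒imageSub reducible y (x₂ , y≐Qx₂)
    with reducible (glue (λ _ → false) x₂)
  ... | y′ , z , y′∈⟨W⟩ , z⊥ , glue≐y′+z = z ∘ e₁ , λ i → begin
    y i                    ≡⟨ y≐Qx₂ i ⟩
    (Q ·ᵥ x₂) i            ≡⟨ Σ₂-cong (λ j → cong (Q i j ∧_) (z≡x₂ j)) ⟨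
    (Q ·ᵥ (z ∘ e₂)) i      ≡⟨ to (perp⇔blocks z) z⊥ i ⟨
    (P ·ᵥ (z ∘ e₁)) i      ∎
    where
    z≡x₂ : ∀ j → z (e₂ j) ≡ x₂ j
    z≡x₂ j = begin
      z (e₂ j)                        ≡⟨ cong (_xor z (e₂ j)) (to (inSpan⇔supported W y′) y′∈⟨W⟩ (e₂ j) (enum-notW o j)) ⟨
      y′ (e₂ j) xor z (e₂ j)          ≡⟨ glue≐y′+z (e₂ j) ⟨
      glue (λ _ → false) x₂ (e₂ j)    ≡⟨ glue-enum _ x₂ (inj₂ j) ⟩
      x₂ j                            ∎

  -- If Q x₂ = P x₁ then z = (x₁ , x₂) is orthogonal to ⟨W⟩ and y = x + z
  -- vanishes off W.
  imageSub⇒reducible : ImageSub Q P → Reducible G W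
  imageSub⇒reducible Q⊆P x with Q⊆P (Q ·ᵥ (x ∘ e₂)) (x ∘ e₂ , λ _ → refl)
  ... | x₁ , Qx₂≐Px₁ =
    y , z , from (inSpan⇔supported W y) y-supported , from (perp⇔blocks z) Pz₁≡Qz₂ , x≐y+z
    where
    z : Vect n
    z = glue x₁ (x ∘ e₂)
    y : Vect n
    y = x +ᵥ z

    x≐y+z : x ≐ (y +ᵥ z)
    x≐y+z v = ≡.sym (begin
      (x v xor z v) xor z v  ≡⟨ xor-assoc (x v) (z v) (z v) ⟩
      x v xor (z v xor z v)  ≡⟨ cong (x v xor_) (xor-same (z v)) ⟩
      x v xor false          ≡⟨ xor-identityʳ (x v) ⟩
      x v                    ∎)

    y-supported : Supported W y
    y-supported = offW-elim {B = λ v → y v ≡ false} λ j → begin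
      x (e₂ j) xor z (e₂ j)  ≡⟨ cong (x (e₂ j) xor_) (glue-enum x₁ _ (inj₂ j)) ⟩
      x (e₂ j) xor x (e₂ j)  ≡⟨ xor-same (x (e₂ j)) ⟩
      false                  ∎

    Pz₁≡Qz₂ : ∀ i → (P ·ᵥ (z ∘ e₁)) i ≡ (Q ·ᵥ (z ∘ e₂)) i
    Pz₁≡Qz₂ i = begin
      (P ·ᵥ (z ∘ e₁)) i  ≡⟨ Σ₂-cong (λ i′ → cong (P i i′ ∧_) (glue-enum x₁ _ (inj₁ i′))) ⟩
      (P ·ᵥ x₁) i        ≡⟨ Qx₂≐Px₁ i ⟨
      (Q ·ᵥ (x ∘ e₂)) i  ≡⟨ Σ₂-cong (λ j → cong (Q i j ∧_) (glue-enum x₁ _ (inj₂ j))) ⟨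
      (Q ·ᵥ (z ∘ e₂)) i  ∎

mainTheorem3 : ∀ {n k m} (G : Graph n) (W : Subset n) (o : WFirst W k m) →
    (Reducible G W ⇔ ImageSub (blockQ G o) (blockP G o))
    × (Reducible G W ⇔ (∃ λ (M : Mat k m) → ∀ i j → blockQ G o i j ≡ (blockP G o · M) i j))
mainTheorem3 G W o = reducible⇔imageSub , ⇔-trans reducible⇔imageSub (imageSub⇔factor Q P)
  where
  open Blocks G W o
  reducible⇔imageSub : Reducible G W ⇔ ImageSub Q P
  reducible⇔imageSub = mk⇔ reducible⇒imageSub imageSub⇒reducible
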